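{- Let $t$ be a normal $\lambda\mu$-term and $y$ a $\lambda$-variable. If $(t\,y)\triangleright^+t'$, then every redex in $t'$ is a $y$-redex preceded by a $\mu$-variable, i.e. each redex occurrence $r$ in $t'$ is of the form $(\lambda x.s\;y)$ or $(\mu\beta.s\;y)$ and occurs in $t'$ inside a subterm $(\alpha\,r)$ for some $\mu$-variable $\alpha$.
   Context: $\lambda\mu$-terms over disjoint infinite sets of $\lambda$-variables and $\mu$-variables: $t ::= x \mid \lambda x.t \mid (t\,t) \mid \mu\alpha.t \mid (\alpha\,t)$. $u[\alpha:=^*v]$ replaces inductively each subterm $(\alpha\,w)$ of $u$ by $(\alpha\,(w\,v))$. One-step reduction $\triangleright$ is the compatible closure of $(\lambda x.u\;v)\triangleright u[x:=v]$ and $(\mu\alpha.u\;v)\triangleright\mu\alpha.u[\alpha:=^*v]$; $\triangleright^+$ is its transitive closure. A redex is a subterm of the form $(\lambda x.u\;v)$ or $(\mu\alpha.u\;v)$; a term is normal if it contains no redex. For a $\lambda$-variable $y$, a $y$-redex is a redex whose argument is $y$, i.e. a term $(\lambda x.s\;y)$ or $(\mu\beta.s\;y)$. -}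

module Defs where

open import Data.Nat using (ℕ; zero; suc; _+_; _∸_; _<ᵇ_; _≡ᵇ_)
open import Data.Bool using (Bool; true; false; if_then_else_)
open import Data.Empty using (⊥)
open import Relation.Nullary using (¬_)

-- λμ-terms in de Bruijn notation, with two disjoint index spaces:
-- λ-variables (bound by lam) and μ-variables (bound by mu).
data Term : Set where
  var   : ℕ → Term
  lam   : Term → Term
  app   : Term → Term → Term
  mu    : Term → Term
  named : ℕ → Term → Term     -- (α t)  with α a μ-variable

lshift : ℕ → Term → Term
lshift c (var n)     = if n <ᵇ c then var n else var (suc n)
lshift c (lam t)     = lam (lshift (suc c) t)
lshift c (app t s)   = app (lshift c t) (lshift c s)
lshift c (mu t)      = mu (lshift c t)
lshift c (named a t) = named a (lshift c t)

mshift : ℕ → Term → Term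
mshift c (var n)     = var n
mshift c (lam t)     = lam (mshift c t)
mshift c (app t s)   = app (mshift c t) (mshift c s)
mshift c (mu t)      = mu (mshift (suc c) t)
mshift c (named a t) = named (if a <ᵇ c then a else suc a) (mshift c t)

-- capture-avoiding substitution  t[j := v]  (removing the binder of j)
lsub : ℕ → Term → Term → Term
lsub j v (var n)     = if n ≡ᵇ j then v else (if j <ᵇ n then var (n ∸ 1) else var n)
lsub j v (lam t)     = lam (lsub (suc j) (lshift 0 v) t)
lsub j v (app t s)   = app (lsub j v t) (lsub j v s)
lsub j v (mu t)      = mu (lsub j (mshift 0 v) t)
lsub j v (named a t) = named a (lsub j v t)

msub : ℕ → Term → Term → Term
msub a v (var n)     = var n
msub a v (lam t)     = lam (msub a (lshift 0 v) t)
msub a v (app t s)   = app (msub a v t) (msub a v s)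
msub a v (mu t)      = mu (msub (suc a) (mshift 0 v) t)
msub a v (named b t) =
  if b ≡ᵇ a then named b (app (msub a v t) v) else named b (msub a v t)

infix 4 _▷_
data _▷_ : Term → Term → Set where
  β     : ∀ {u v} → app (lam u) v ▷ lsub 0 v u
  μ     : ∀ {u v} → app (mu u) v ▷ mu (msub 0 (mshift 0 v) u)
  ξlam  : ∀ {t t'} → t ▷ t' → lam t ▷ lam t'
  ξappL : ∀ {t t' s} → t ▷ t' → app t s ▷ app t' s
  ξappR : ∀ {t s s'} → s ▷ s' → app t s ▷ app t s'
  ξmu   : ∀ {t t'} → t ▷ t' → mu t ▷ mu t'
  ξnamed : ∀ {a t t'} → t ▷ t' → named a t ▷ named a t'

data Redex : Term → Set where
  βredex : ∀ {u v} → Redex (app (lam u) v)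
  μredex : ∀ {u v} → Redex (app (mu u) v)

-- y-redexes, where y is given as the de Bruijn index n valid at the
-- position of the redex
data YRedex (n : ℕ) : Term → Set where
  yβ : ∀ {s} → YRedex n (app (lam s) (var n))
  yμ : ∀ {s} → YRedex n (app (mu s) (var n))

-- Child u j b r : r is an immediate subterm of u, passing j λ-binders;
-- b = true iff u is of the form (α r).
data Child : Term → ℕ → Bool → Term → Set where
  c-lam   : ∀ {t} → Child (lam t) 1 false t
  c-appL  : ∀ {t s} → Child (app t s) 0 false t
  c-appR  : ∀ {t s} → Child (app t s) 0 false s
  c-mu    : ∀ {t} → Child (mu t) 0 false t
  c-named : ∀ {a t} → Child (named a t) 0 true t

-- Occ t k b r : a (specific) occurrence of r in t, below k λ-binders,
-- whose immediate parent is of the form (α r) iff b = true.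
data Occ (t : Term) : ℕ → Bool → Term → Set where
  top  : Occ t 0 false t
  down : ∀ {k b' u j b r} → Occ t k b' u → Child u j b r → Occ t (j + k) b r

Normal : Term → Set
Normal t = ∀ {k b r} → Occ t k b r → ¬ Redex r

module Submission where

-- After (t y) ▷⁺ t' the only
-- redexes are those created by pushing y through a μ-binder: a μ-variable α
-- is "pending" while its occurrences (α w) may still receive the argument y,
-- and "fired" once y has been pushed into them, turning (α w) into (α (w y)).
-- We define an invariant  Tame F y p t  on terms, parametrised by a flag
-- F α (true = pending, false = fired) for every free μ-variable, and by the
-- position p of t: directly below a pending name, directly below a fired
-- name, or elsewhere.  A tame term has a redex only as a y-redex directly
-- below a fired name.

open import Defs
open import Data.Nat using (ℕ; zero; suc; _+_; _∸_; _<ᵇ_; _≡ᵇ_)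
open import Data.Nat.Properties using (≡ᵇ⇒≡; +-suc; +-assoc)
open import Data.Bool using (Bool; true; false; T)
open import Data.Unit using (tt)
open import Data.Empty using (⊥; ⊥-elim)
open import Data.Product using (_×_; Σ; _,_; proj₂)
open import Relation.Binary.PropositionalEquality
  using (_≡_; refl; sym; subst; cong)
open import Relation.Binary.Construct.Closure.Transitive
  using (TransClosure; [_]; _∷_)

-- Flags of the free μ-variables: true = pending, false = fired.
Flags : Set
Flags = ℕ → Bool

infixr 5 _∷ᶠ_
_∷ᶠ_ : Bool → Flags → Flags
(b ∷ᶠ F) zero    = b
(b ∷ᶠ F) (suc n) = F n

data Position : Set where
  plain pendingArg firedArg : Position

positionBelow : Bool → Position
positionBelow true  = pendingArg
positionBelow false = firedArg

-- Terms that are not abstractions, i.e. cannot be the head of a redex.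
data NotAbs : Term → Set where
  var   : ∀ {n} → NotAbs (var n)
  app   : ∀ {p q} → NotAbs (app p q)
  named : ∀ {a s} → NotAbs (named a s)

-- A μ-abstraction directly below a pending name must bind a pending
-- variable: firing the outer name creates a μ-redex with argument y, whose
-- contraction fires the inner variable.
data AllowedFlag : Position → Bool → Set where
  pending    : ∀ {p} → AllowedFlag p true
  firedPlain : AllowedFlag plain false
  firedFired : AllowedFlag firedArg false

-- The invariant.  y is the de Bruijn index of the argument variable at the
-- current depth.
data Tame (F : Flags) (y : ℕ) : Position → Term → Set where
  var   : ∀ {p n} → Tame F y p (var n)
  lam   : ∀ {p s} → Tame F (suc y) plain s → Tame F y p (lam s)
  mu    : ∀ {p s b} → Tame (b ∷ᶠ F) y plain s → AllowedFlag p b → Tame F y p (mu s)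
  named : ∀ {p a s} → Tame F y (positionBelow (F a)) s → Tame F y p (named a s)
  app   : ∀ {p u v} → NotAbs u → Tame F y plain u → Tame F y plain v →
          Tame F y p (app u v)
  yβ    : ∀ {s} → Tame F (suc y) plain s → Tame F y firedArg (app (lam s) (var y))
  yμ    : ∀ {s} → Tame (true ∷ᶠ F) y plain s → Tame F y firedArg (app (mu s) (var y))

plain⇒firedArg : ∀ {F y t} → Tame F y plain t → Tame F y firedArg t
plain⇒firedArg var                    = var
plain⇒firedArg (lam h)                = lam h
plain⇒firedArg (mu h pending)         = mu h pending
plain⇒firedArg (mu h firedPlain)      = mu h firedFired
plain⇒firedArg (named h)              = named h
plain⇒firedArg (app u h₁ h₂)          = app u h₁ h₂

-- Renaming the λ-variable at index j to y is the β-contraction of a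
-- y-redex, performed below j further λ-binders.

data IsVar : Term → Set where
  var : ∀ {n} → IsVar (var n)

lsub-var-var : ∀ j m n → IsVar (lsub j (var m) (var n))
lsub-var-var j m n with n ≡ᵇ j | j <ᵇ n
... | true  | _     = var
... | false | true  = var
... | false | false = var

notAbs-lsub : ∀ {j m u} → NotAbs u → NotAbs (lsub j (var m) u)
notAbs-lsub {j} {m} (var {n}) with lsub j (var m) (var n) | lsub-var-var j m n
... | _ | var = var
notAbs-lsub app   = app
notAbs-lsub named = named

-- Below j binders, the argument y has index j + suc y while the substituted
-- binder is still present: it is strictly above index j ...
argument≢substituted : ∀ j y → (j + suc y ≡ᵇ j) ≡ false
argument≢substituted zero    y = refl
argument≢substituted (suc j) y = argument≢substituted j y

substituted<argument : ∀ j y → (j <ᵇ j + suc y) ≡ true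
substituted<argument zero    y = refl
substituted<argument (suc j) y = substituted<argument j y

-- ... so removing that binder turns it into index j + y.
lsub-argument : ∀ j y → lsub j (var (j + y)) (var (j + suc y)) ≡ var (j + y)
lsub-argument j y
  rewrite argument≢substituted j y | substituted<argument j y | cong (_∸ 1) (+-suc j y) = refl

tame-lsub : ∀ {F j y p u} → Tame F (j + suc y) p u →
            Tame F (j + y) p (lsub j (var (j + y)) u)
tame-lsub {j = j} {y} {u = var n} var
  with lsub j (var (j + y)) (var n) | lsub-var-var j (j + y) n
... | _ | var = var
tame-lsub {j = j} (lam h)   = lam (tame-lsub {j = suc j} h)
tame-lsub (mu h ok)         = mu (tame-lsub h) ok
tame-lsub (named h)         = named (tame-lsub h)
tame-lsub (app u h₁ h₂)     = app (notAbs-lsub u) (tame-lsub h₁) (tame-lsub h₂)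
tame-lsub {j = j} {y} (yβ h) rewrite lsub-argument j y = yβ (tame-lsub {j = suc j} h)
tame-lsub {j = j} {y} (yμ h) rewrite lsub-argument j y = yμ (tame-lsub h)

record Fires (a : ℕ) (F G : Flags) : Set where
  field
    wasPending : F a ≡ true
    nowFired   : G a ≡ false
    others     : ∀ n → (n ≡ᵇ a) ≡ false → F n ≡ G n
open Fires

fires-zero : ∀ {F} → Fires 0 (true ∷ᶠ F) (false ∷ᶠ F)
fires-zero = record { wasPending = refl ; nowFired = refl ; others = agree }
  where
  agree : ∀ {F} n → (n ≡ᵇ 0) ≡ false → (true ∷ᶠ F) n ≡ (false ∷ᶠ F) n
  agree (suc n) _ = refl

fires-under : ∀ {a F G} b → Fires a F G → Fires (suc a) (b ∷ᶠ F) (b ∷ᶠ G)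
fires-under b f = record { wasPending = wasPending f ; nowFired = nowFired f
                         ; others = agree }
  where
  agree : ∀ n → (n ≡ᵇ suc _) ≡ false → (b ∷ᶠ _) n ≡ (b ∷ᶠ _) n
  agree zero    _ = refl
  agree (suc n) e = others f n e

notAbs-msub : ∀ {a v u} → NotAbs u → NotAbs (msub a v u)
notAbs-msub var = var
notAbs-msub app = app
notAbs-msub {a} (named {b}) with b ≡ᵇ a
... | true  = named
... | false = named

reposition : ∀ {F y c c' s} → c ≡ c' →
             Tame F y (positionBelow c) s → Tame F y (positionBelow c') s
reposition refl h = h

mutual
  tame-fire : ∀ {F G y p a u} → Fires a F G →
              Tame F y p u → Tame G y p (msub a (var y) u)
  tame-fire f var         = var
  tame-fire f (lam h)     = lam (tame-fire f h)
  tame-fire f (mu {b = b} h ok) = mu (tame-fire (fires-under b f) h) ok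
  tame-fire {a = a} f (named {a = b} h) with b ≡ᵇ a in eq
  ... | true with refl ← ≡ᵇ⇒≡ b a (subst T (sym eq) tt) =
        named (reposition (sym (nowFired f))
                 (tame-fire-pendingArg f (reposition (wasPending f) h)))
  ... | false = named (reposition (others f b eq) (tame-fire f h))
  tame-fire f (app u h₁ h₂) = app (notAbs-msub u) (tame-fire f h₁) (tame-fire f h₂)
  tame-fire f (yβ h)      = yβ (tame-fire f h)
  tame-fire f (yμ h)      = yμ (tame-fire (fires-under true f) h)

  -- A body w of the fired name becomes (w y): a y-redex if w is an
  -- abstraction (whose μ-variable is then pending), an application otherwise.
  tame-fire-pendingArg : ∀ {F G y a s} → Fires a F G → Tame F y pendingArg s →
                         Tame G y firedArg (app (msub a (var y) s) (var y))
  tame-fire-pendingArg f var             = app var var var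
  tame-fire-pendingArg f (lam h)         = yβ (tame-fire f h)
  tame-fire-pendingArg f (mu h pending)  = yμ (tame-fire (fires-under true f) h)
  tame-fire-pendingArg {a = a} f (named {a = b} {s} h) =
    app (notAbs-msub {a} (named {b} {s})) (tame-fire f (named h)) var
  tame-fire-pendingArg f (app u h₁ h₂)   = app app (tame-fire f (app u h₁ h₂)) var

contract-β : ∀ {F y s} → Tame F (suc y) plain s → Tame F y plain (lsub 0 (var y) s)
contract-β = tame-lsub {j = 0}

contract-μ : ∀ {F y s} → Tame (true ∷ᶠ F) y plain s →
             Tame F y plain (mu (msub 0 (var y) s))
contract-μ h = mu (tame-fire fires-zero h) firedPlain

-- The head of a tame application is not a redex, so it stays a non-abstraction.
notAbs-step : ∀ {F y u u'} → NotAbs u → Tame F y plain u → u ▷ u' → NotAbs u'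
notAbs-step app (app () _ _) β
notAbs-step app (app () _ _) μ
notAbs-step app _ (ξappL _)      = app
notAbs-step app _ (ξappR _)      = app
notAbs-step named _ (ξnamed _)   = named

tame-step : ∀ {F y p t t'} → Tame F y p t → t ▷ t' → Tame F y p t'
tame-step (app () _ _) β
tame-step (app () _ _) μ
tame-step (yβ h) β                 = plain⇒firedArg (contract-β h)
tame-step (yμ h) μ                 = plain⇒firedArg (contract-μ h)
tame-step (lam h) (ξlam s)         = lam (tame-step h s)
tame-step (app u h₁ h₂) (ξappL s)  = app (notAbs-step u h₁ s) (tame-step h₁ s) h₂
tame-step (app u h₁ h₂) (ξappR s)  = app u h₁ (tame-step h₂ s)
tame-step (yβ h) (ξappL (ξlam s))  = yβ (tame-step h s)
tame-step (yμ h) (ξappL (ξmu s))   = yμ (tame-step h s)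
tame-step (mu h ok) (ξmu s)        = mu (tame-step h s) ok
tame-step (named h) (ξnamed s)     = named (tame-step h s)

tame-steps : ∀ {F y t t'} → Tame F y plain t → TransClosure _▷_ t t' → Tame F y plain t'
tame-steps h [ s ]    = tame-step h s
tame-steps h (s ∷ ss) = tame-steps (tame-step h s) ss

occ-through : ∀ {t j b₀ s k b r} → Child t j b₀ s → Occ s k b r →
              Σ ℕ λ k' → Σ Bool λ b' → Occ t k' b' r
occ-through c top = _ , _ , down top c
occ-through c (down o c') with occ-through c o
... | _ , _ , o' = _ , _ , down o' c'

normal-child : ∀ {t j b s} → Normal t → Child t j b s → Normal s
normal-child nt c o = nt (proj₂ (proj₂ (occ-through c o)))

normal-irreducible : ∀ {t t'} → Normal t → t ▷ t' → ⊥
normal-irreducible nt β          = nt top βredex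
normal-irreducible nt μ          = nt top μredex
normal-irreducible nt (ξlam s)   = normal-irreducible (normal-child nt c-lam) s
normal-irreducible nt (ξappL s)  = normal-irreducible (normal-child nt c-appL) s
normal-irreducible nt (ξappR s)  = normal-irreducible (normal-child nt c-appR) s
normal-irreducible nt (ξmu s)    = normal-irreducible (normal-child nt c-mu) s
normal-irreducible nt (ξnamed s) = normal-irreducible (normal-child nt c-named) s

normal-head : ∀ u v → Normal (app u v) → NotAbs u
normal-head (var _) v nt     = var
normal-head (lam _) v nt     = ⊥-elim (nt top βredex)
normal-head (app _ _) v nt   = app
normal-head (mu _) v nt      = ⊥-elim (nt top μredex)
normal-head (named _ _) v nt = named

normal-tame : ∀ {F y p t} → Normal t → Tame F y p t
normal-tame {t = var _} nt     = var
normal-tame {t = lam _} nt     = lam (normal-tame (normal-child nt c-lam))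
normal-tame {t = mu _} nt      = mu {b = true} (normal-tame (normal-child nt c-mu)) pending
normal-tame {t = named _ _} nt = named (normal-tame (normal-child nt c-named))
normal-tame {t = app u v} nt   =
  app (normal-head u v nt) (normal-tame (normal-child nt c-appL))
      (normal-tame (normal-child nt c-appR))

allPending : Flags
allPending _ = true

-- The first step from (t y) contracts the top redex, giving a tame term.
first-step-tame : ∀ {t y t₁} → Normal t → app t (var y) ▷ t₁ → Tame allPending y plain t₁
first-step-tame nt β         = contract-β (normal-tame (normal-child nt c-lam))
first-step-tame nt μ         = contract-μ (normal-tame (normal-child nt c-mu))
first-step-tame nt (ξappL s) = ⊥-elim (normal-irreducible nt s)
first-step-tame nt (ξappR ())

reduct-tame : ∀ {t y t'} → Normal t → TransClosure _▷_ (app t (var y)) t' →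
              Tame allPending y plain t'
reduct-tame nt [ s ]    = first-step-tame nt s
reduct-tame nt (s ∷ ss) = tame-steps (first-step-tame nt s) ss

record TameOccurrence (y' : ℕ) (b : Bool) (r : Term) : Set where
  constructor tameOccurrence
  field
    {flags}     : Flags
    {position}  : Position
    tame        : Tame flags y' position r
    belowName   : position ≡ firedArg → b ≡ true

tame-child : ∀ {F y p u j b r} → Tame F y p u → Child u j b r → TameOccurrence (j + y) b r
tame-child (lam h) c-lam        = tameOccurrence h λ ()
tame-child (mu h _) c-mu        = tameOccurrence h λ ()
tame-child (named h) c-named    = tameOccurrence h λ _ → refl
tame-child (app _ h _) c-appL   = tameOccurrence h λ ()
tame-child (app _ _ h) c-appR   = tameOccurrence h λ ()
tame-child (yβ h) c-appL        = tameOccurrence {position = plain} (lam h) λ ()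
tame-child {F} (yβ h) c-appR    = tameOccurrence {flags = F} {plain} var λ ()
tame-child (yμ h) c-appL        = tameOccurrence {position = plain} (mu h pending) λ ()
tame-child {F} (yμ h) c-appR    = tameOccurrence {flags = F} {plain} var λ ()

tame-occ : ∀ {F y t k b r} → Tame F y plain t → Occ t k b r → TameOccurrence (k + y) b r
tame-occ h top = tameOccurrence h λ ()
tame-occ {y = y} {b = b} {r = r} h (down {k = k} {j = j} o c) with tame-occ h o
... | tameOccurrence h' _ =
  subst (λ d → TameOccurrence d b r) (sym (+-assoc j k y)) (tame-child h' c)

tame-redex : ∀ {F y p r} → Tame F y p r → Redex r → YRedex y r × p ≡ firedArg
tame-redex (app () _ _) βredex
tame-redex (app () _ _) μredex
tame-redex (yβ _) βredex = yβ , refl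
tame-redex (yμ _) μredex = yμ , refl

lemma3p3 : (t : Term) (y : ℕ) (t' : Term) → Normal t →
    TransClosure _▷_ (app t (var y)) t' →
    ∀ {k b r} → Occ t' k b r → Redex r → YRedex (k + y) r × b ≡ true
lemma3p3 t y t' nt steps o rr with tame-occ (reduct-tame nt steps) o
... | tameOccurrence h belowName with tame-redex h rr
... | yr , fired = yr , belowName fired
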